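{- Let $L$ be a Latin square of order $10$ whose rows $6,\dots,9$ and columns $6,\dots,9$ form a $4\times4$ Latin subsquare on the symbols $\{0,1,2,3\}$, coloured as described in the context, and let $P,Q$ be Latin squares of order $10$ such that $(P,Q)$, $(P,L)$ and $(Q,L)$ are coloured TRPs. Then $(P,Q)$ is equivalent to a coloured TRP $(P',Q')$ in normal form, and the lower-right $4\times4$ Latin subsquare of $L$ can be taken to be $\Omega_1$ or $\Omega_2$; that is, applying to $L$ the same column and symbol permutations used in the transformation of $(P,Q)$ into $(P',Q')$, together with a permutation of the rows of $L$, yields a Latin square $L'$ whose subsquare in rows and columns $6,\dots,9$ is $\Omega_1$ or $\Omega_2$ and such that $(P',L')$ and $(Q',L')$ are coloured TRPs.
   Context: Squares have rows, columns indexed $\{0,\dots,9\}$ and symbols $\{0,\dots,9\}$. Two Latin squares $A,B$ form a TRP (transversal representation pair) if for all $i,i',j,j'$: $A[i,j]=B[i',j]$ and $A[i,j']=B[i',j']$ imply $j=j'$. The square $L$ is coloured as follows: a cell is white if its symbol lies in $\{0,1,2,3\}$; a cell in rows $0,\dots,5$ and columns $0,\dots,5$ with symbol in $\{4,\dots,9\}$ is dark; all other cells are light. If $(P,L)$ is a TRP, each cell $(i,j)$ of $P$ with $P[i,j]=k$ receives the colour of the cell in column $j$ of $L$ containing symbol $k$; a coloured TRP is a TRP with these induced colourings (and $(P,Q)$ is a coloured TRP when $P$, $Q$ carry these colourings and $(P,Q)$ is a TRP). A row of $P$ is of transversal type $p_k$ if it has exactly $k$ white cells among columns $6,\dots,9$.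 Two coloured TRPs are equivalent if one is obtained from the other by a composition of: permutations of the rows of $P$; permutations of the rows of $Q$; permutations of columns $0,\dots,5$ among themselves and of columns $6,\dots,9$ among themselves, applied simultaneously to $P$ and $Q$; permutations of the symbols that map $\{0,1,2,3\}$ to itself and $\{4,\dots,9\}$ to itself, applied simultaneously to $P$ and $Q$. A coloured TRP $(P,Q)$ is in normal form if in each of $P$ and $Q$ the rows are sorted by transversal type (if row $i$ has type $p_k$ and row $i'\ge i$ has type $p_{k'}$ then $k\le k'$), rows of the same transversal type are in increasing lexicographic order, and the first row of $P$ is one of $[0,1,2,4,5,6,3,7,8,9]$, $[0,1,3,4,5,6,2,7,8,9]$, $[0,2,3,4,5,6,1,7,8,9]$ with cells in columns $0,1,2,6$ white and cells in columns $3,4,5,7,8,9$ light. $\Omega_1$ has rows $[0,1,2,3],[1,2,3,0],[2,3,0,1],[3,0,1,2]$ and $\Omega_2$ has rows $[0,1,2,3],[1,0,3,2],[2,3,0,1],[3,2,1,0]$. -}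

module Defs where

open import Data.Nat using (ℕ; _<_; _≤_; _<ᵇ_)
open import Data.Nat.Properties using (_<?_)
open import Data.Bool using (if_then_else_; _∧_)
open import Data.Fin using (Fin; toℕ; _↑ʳ_; zero; #_)
open import Data.Fin.Permutation using (Permutation′; _⟨$⟩ʳ_)
open import Data.List using (length; filter; allFin)
open import Data.Vec using (Vec; []; _∷_; lookup)
open import Data.Product using (Σ; ∃; _×_; _,_)
open import Data.Sum using (_⊎_)
open import Function.Bundles using (_⇔_)
open import Relation.Binary.PropositionalEquality using (_≡_)

Square : Set
Square = Fin 10 → Fin 10 → Fin 10

-- Latin square: every symbol occurs at most once in each row and each column
-- (with 10 cells and 10 symbols this is "exactly once").
IsLatin : Square → Set
IsLatin A = (∀ i j j′ → A i j ≡ A i j′ → j ≡ j′)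
          × (∀ j i i′ → A i j ≡ A i′ j → i ≡ i′)

IsTRP : Square → Square → Set
IsTRP A B = ∀ i i′ j j′ → A i j ≡ B i′ j → A i j′ ≡ B i′ j′ → j ≡ j′

data Colour : Set where
  white dark light : Colour

colourL : Square → Fin 10 → Fin 10 → Colour
colourL L r j =
  if toℕ (L r j) <ᵇ 4 then white
  else (if (toℕ r <ᵇ 6) ∧ (toℕ j <ᵇ 6) then dark else light)

HasColour : Square → Square → Fin 10 → Fin 10 → Colour → Set
HasColour L P i j c = ∃ λ r → L r j ≡ P i j × colourL L r j ≡ c

ttype : Square → Fin 10 → ℕ
ttype P i = length (filter (λ b → toℕ (P i ((6 ↑ʳ b))) <? 4) (allFin 4))

LexLt : (Fin 10 → Fin 10) → (Fin 10 → Fin 10) → Set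
LexLt r s = ∃ λ k → (∀ j → toℕ j < toℕ k → r j ≡ s j) × toℕ (r k) < toℕ (s k)

RowsSorted : Square → Set
RowsSorted P = ∀ i i′ → toℕ i < toℕ i′ →
  ttype P i ≤ ttype P i′ × (ttype P i ≡ ttype P i′ → LexLt (P i) (P i′))

row₁ row₂ row₃ : Vec (Fin 10) 10
row₁ = # 0 ∷ # 1 ∷ # 2 ∷ # 4 ∷ # 5 ∷ # 6 ∷ # 3 ∷ # 7 ∷ # 8 ∷ # 9 ∷ []
row₂ = # 0 ∷ # 1 ∷ # 3 ∷ # 4 ∷ # 5 ∷ # 6 ∷ # 2 ∷ # 7 ∷ # 8 ∷ # 9 ∷ []
row₃ = # 0 ∷ # 2 ∷ # 3 ∷ # 4 ∷ # 5 ∷ # 6 ∷ # 1 ∷ # 7 ∷ # 8 ∷ # 9 ∷ []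

NormalForm : Square → Square → Square → Set
NormalForm L P Q =
  RowsSorted P × RowsSorted Q ×
  ((∀ j → P zero j ≡ lookup row₁ j) ⊎ (∀ j → P zero j ≡ lookup row₂ j)
     ⊎ (∀ j → P zero j ≡ lookup row₃ j)) ×
  HasColour L P zero (# 0) white × HasColour L P zero (# 1) white ×
  HasColour L P zero (# 2) white × HasColour L P zero (# 6) white ×
  HasColour L P zero (# 3) light × HasColour L P zero (# 4) light ×
  HasColour L P zero (# 5) light × HasColour L P zero (# 7) light ×
  HasColour L P zero (# 8) light × HasColour L P zero (# 9) light

Ω₁ Ω₂ : Vec (Vec (Fin 10) 4) 4
Ω₁ = (# 0 ∷ # 1 ∷ # 2 ∷ # 3 ∷ []) ∷ (# 1 ∷ # 2 ∷ # 3 ∷ # 0 ∷ []) ∷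
     (# 2 ∷ # 3 ∷ # 0 ∷ # 1 ∷ []) ∷ (# 3 ∷ # 0 ∷ # 1 ∷ # 2 ∷ []) ∷ []
Ω₂ = (# 0 ∷ # 1 ∷ # 2 ∷ # 3 ∷ []) ∷ (# 1 ∷ # 0 ∷ # 3 ∷ # 2 ∷ []) ∷
     (# 2 ∷ # 3 ∷ # 0 ∷ # 1 ∷ []) ∷ (# 3 ∷ # 2 ∷ # 1 ∷ # 0 ∷ []) ∷ []

SubsquareIs : Square → Vec (Vec (Fin 10) 4) 4 → Set
SubsquareIs L Ω = ∀ a b → L ((6 ↑ʳ a)) ((6 ↑ʳ b)) ≡ lookup (lookup Ω a) b

LowerRightOn0123 : Square → Set
LowerRightOn0123 L = ∀ a b → toℕ (L ((6 ↑ʳ a)) ((6 ↑ʳ b))) < 4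

ColPerm : Permutation′ 10 → Set
ColPerm γ = ∀ x → (toℕ x < 6) ⇔ (toℕ (γ ⟨$⟩ʳ x) < 6)

SymPerm : Permutation′ 10 → Set
SymPerm π = ∀ x → (toℕ x < 4) ⇔ (toℕ (π ⟨$⟩ʳ x) < 4)

transform : Permutation′ 10 → Permutation′ 10 → Permutation′ 10 → Square → Square
transform ρ γ π A i j = π ⟨$⟩ʳ A (ρ ⟨$⟩ʳ i) (γ ⟨$⟩ʳ j)

{-# OPTIONS --safe #-}
module Submission where

-- Every row of P has transversal type at least 1.  Fix a row i and send each column j to the row of L
-- holding the symbol P[i,j] in column j; by the TRP property this is a bijection from columns to rows.
-- Row i has four white cells, and four columns are sent into the rows 6–9 of L.  The white symbols of
-- those rows all lie in the subsquare, so a column j < 6 is never both, whereas a column j ≥ 6 is white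
-- exactly when it is sent into rows 6–9; counting columns gives 4 + 4 ≤ 6 + 2t for the type t of row i.
-- As columns 6–9 of P hold only 16 white cells, some row R has type exactly 1, its white cell there
-- lying in some column c with some symbol s.
--
-- The subsquare of L is reduced with respect to column c and a row in which that column does not hold
-- s.  Of the four reduced Latin squares of order 4, two are Ω₁ and Ω₂ and the other two are isomorphic
-- to Ω₁ by an isomorphism fixing 0; the resulting isotopy moves column c to column 6 and s to a nonzero
-- symbol m.  Permuting columns 0–5 and the symbols 4–9 then turns row R into the normal-form row with
-- m in column 6, and sorting puts R first: its type 1 is least and it has symbol 0 in column 0.  Its
-- cells in columns 3, 4, 5 are light since the rows 6–9 of L meet it in four distinct columns, all
-- among 3, 4, 5, 6.

open import Defs
open import Data.Bool using (true; false)
import Data.Bool.Properties as Boolₚ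
open import Data.Fin as Fin using (Fin; zero; suc; toℕ; fromℕ<; _↑ˡ_; _↑ʳ_; #_)
open import Data.Fin.Patterns using (0F; 1F; 2F; 3F)
open import Data.Fin.Permutation
  using (Permutation; Permutation′; _⟨$⟩ʳ_; _⟨$⟩ˡ_; permutation; inverseˡ; inverseʳ; flip; _∘ₚ_; transpose)
  renaming (id to idₚ)
import Data.Fin.Properties as Finₚ
open import Data.List as List using (List; []; _∷_; length; filter)
open import Data.List.Relation.Unary.All as All using (All; all?)
import Data.Nat.ListAction as ListAction
open import Data.Nat using (ℕ; zero; suc; _+_; _≤_; _<_; z≤n; s≤s; _<ᵇ_)
open import Data.Nat.Properties
open import Algebra.Properties.CommutativeMonoid.Sum +-0-commutativeMonoid
  using (sum; sum-cong-≗; sum-replicate-zero; ∑-comm; ∑-permute; ∑-distrib-+)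
open import Data.Product using (Σ; ∃; ∃₂; _×_; _,_; proj₁; proj₂)
open import Data.Sum as Sum using (_⊎_; inj₁; inj₂)
open import Data.Sum.Function.Propositional using (_⊎-↔_)
open import Data.Unit using (⊤; tt)
open import Data.Vec as Vec using (Vec; []; _∷_; lookup)
import Data.Vec.Properties as Vecₚ
open import Function using (_∘_; Injective; _⇔_; mk⇔; Equivalence; Injection)
open import Function.Construct.Composition using (_⇔-∘_)
open import Function.Properties.Inverse using (↔-trans; ↔-sym; ↔⇒↣)
open import Relation.Binary.Definitions using (tri<; tri≈; tri>)
open import Relation.Binary.PropositionalEquality
open import Relation.Nullary using (Dec; yes; no; ¬_; contradiction)
open import Relation.Nullary.Decidable
  using (True; False; toWitness; toWitnessFalse; from-yes; from-no; ¬?; _×-dec_; _⊎-dec_; _→-dec_)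

-- Permutations of finite sets

-- Several definitions below are opaque: they are only ever used through their types, and letting
-- the type checker unfold them (here, the search for preimages) makes checking blow up.
opaque
  injective⇒surjective : ∀ {n} {f : Fin n → Fin n} → Injective _≡_ _≡_ f → ∀ y → ∃ λ x → f x ≡ y
  injective⇒surjective {zero}  _     ()
  injective⇒surjective {suc n} {f} f-inj y with Finₚ.any? (λ x → f x Finₚ.≟ y)
  ... | yes hit = hit
  ... | no miss = contradiction (Finₚ.injective⇒≤ punched-injective) (<-irrefl refl)
    where
    punched : Fin (suc n) → Fin n
    punched x = Fin.punchOut {i = y} (λ y≡fx → miss (x , sym y≡fx))
    punched-injective : Injective _≡_ _≡_ punched
    punched-injective = f-inj ∘ Finₚ.punchOut-injective {i = y} _ _

fromInjective : ∀ {n} (f : Fin n → Fin n) → Injective _≡_ _≡_ f → Permutation′ n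
fromInjective f f-inj =
  permutation f (proj₁ ∘ onto) (proj₂ ∘ onto) (λ x → f-inj (proj₂ (onto (f x))))
  where onto = injective⇒surjective f-inj

⟨$⟩ʳ-injective : ∀ {m n} (π : Permutation m n) → Injective _≡_ _≡_ (π ⟨$⟩ʳ_)
⟨$⟩ʳ-injective π = Injection.injective (↔⇒↣ π)

infixr 6 _⊕_

_⊕_ : ∀ {m n} → Permutation′ m → Permutation′ n → Permutation′ (m + n)
π ⊕ π′ = ↔-trans Finₚ.+↔⊎ (↔-trans (π ⊎-↔ π′) (↔-sym Finₚ.+↔⊎))

⊕-↑ˡ : ∀ {m n} (π : Permutation′ m) (π′ : Permutation′ n) a →
       (π ⊕ π′) ⟨$⟩ʳ (a ↑ˡ n) ≡ (π ⟨$⟩ʳ a) ↑ˡ n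
⊕-↑ˡ {m} {n} π π′ a rewrite Finₚ.splitAt-↑ˡ m a n = refl

⊕-↑ʳ : ∀ {m n} (π : Permutation′ m) (π′ : Permutation′ n) b →
       (π ⊕ π′) ⟨$⟩ʳ (m ↑ʳ b) ≡ m ↑ʳ (π′ ⟨$⟩ʳ b)
⊕-↑ʳ {m} {n} π π′ b rewrite Finₚ.splitAt-↑ʳ m n b = refl

data SplitView (m n : ℕ) : Fin (m + n) → Set where
  left  : (a : Fin m) → SplitView m n (a ↑ˡ n)
  right : (b : Fin n) → SplitView m n (m ↑ʳ b)

splitView : ∀ m n x → SplitView m n x
splitView zero    n x       = right x
splitView (suc m) n zero    = left zero
splitView (suc m) n (suc x) with splitView m n x
... | left a  = left (suc a)
... | right b = right b

↑ˡ-below : ∀ {m} n (a : Fin m) → toℕ (a ↑ˡ n) < m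
↑ˡ-below n a = subst (_< _) (sym (Finₚ.toℕ-↑ˡ a n)) (Finₚ.toℕ<n a)

↑ʳ-notBelow : ∀ m {n} (b : Fin n) → m ≤ toℕ (m ↑ʳ b)
↑ʳ-notBelow m b = subst (m ≤_) (sym (Finₚ.toℕ-↑ʳ m b)) (m≤m+n m (toℕ b))

below⇒↑ˡ : ∀ {m n} {x : Fin (m + n)} → toℕ x < m → ∃ λ (a : Fin m) → a ↑ˡ n ≡ x
below⇒↑ˡ {n = n} x<m =
  fromℕ< x<m , Finₚ.toℕ-injective (trans (Finₚ.toℕ-↑ˡ _ n) (Finₚ.toℕ-fromℕ< x<m))

PreservesBelow : ∀ {n} → ℕ → Permutation′ n → Set
PreservesBelow k π = ∀ x → (toℕ x < k) ⇔ (toℕ (π ⟨$⟩ʳ x) < k)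

⊕-preservesBelow : ∀ {m n} (π : Permutation′ m) (π′ : Permutation′ n) → PreservesBelow m (π ⊕ π′)
⊕-preservesBelow {m} {n} π π′ x with splitView m n x
... | left a  rewrite ⊕-↑ˡ π π′ a = mk⇔ (λ _ → ↑ˡ-below n (π ⟨$⟩ʳ a)) (λ _ → ↑ˡ-below n a)
... | right b rewrite ⊕-↑ʳ π π′ b =
  mk⇔ (λ b< → contradiction b< (≤⇒≯ (↑ʳ-notBelow m b)))
      (λ πb< → contradiction πb< (≤⇒≯ (↑ʳ-notBelow m (π′ ⟨$⟩ʳ b))))

∘ₚ-preservesBelow : ∀ {n k} {π ρ : Permutation′ n} →
  PreservesBelow k π → PreservesBelow k ρ → PreservesBelow k (π ∘ₚ ρ)
∘ₚ-preservesBelow {π = π} π-preserves ρ-preserves x = ρ-preserves (π ⟨$⟩ʳ x) ⇔-∘ π-preserves x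

fixesBelow⇒preservesBelow : ∀ {n k} {π : Permutation′ n} →
  (∀ x → toℕ x < k → π ⟨$⟩ʳ x ≡ x) → PreservesBelow k π
fixesBelow⇒preservesBelow {k = k} {π} fixes x =
  mk⇔ (λ x< → subst (λ y → toℕ y < k) (sym (fixes x x<)) x<)
      (λ πx< → subst (λ y → toℕ y < k) (⟨$⟩ʳ-injective π (fixes _ πx<)) πx<)

transpose-source : ∀ {n} (i j : Fin n) → transpose i j ⟨$⟩ʳ i ≡ j
transpose-source i j with i Finₚ.≟ i
... | yes _  = refl
... | no i≢i = contradiction refl i≢i

transpose-fixes : ∀ {n} {i j k : Fin n} → k ≢ i → k ≢ j → transpose i j ⟨$⟩ʳ k ≡ k
transpose-fixes {i = i} {j} {k} k≢i k≢j with k Finₚ.≟ i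
... | yes k≡i = contradiction k≡i k≢i
... | no _ with k Finₚ.≟ j
...   | yes k≡j = contradiction k≡j k≢j
...   | no _    = refl

injection-extends : ∀ {m N} {e f : Fin m → Fin N} → Injective _≡_ _≡_ e → Injective _≡_ _≡_ f →
  ∃ λ (θ : Permutation′ N) → ∀ i → θ ⟨$⟩ʳ e i ≡ f i
injection-extends {zero} _ _ = idₚ , λ ()
injection-extends {suc m} {e = e} {f} e-inj f-inj
  with injection-extends {e = e ∘ suc} {f ∘ suc} (Finₚ.suc-injective ∘ e-inj) (Finₚ.suc-injective ∘ f-inj)
... | θ , θ-extends = transpose (e zero) z ∘ₚ θ , extends
  where
  z = θ ⟨$⟩ˡ f zero
  extends : ∀ i → θ ⟨$⟩ʳ (transpose (e zero) z ⟨$⟩ʳ e i) ≡ f i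
  extends zero    = trans (cong (θ ⟨$⟩ʳ_) (transpose-source (e zero) z)) (inverseʳ θ)
  extends (suc i) = trans (cong (θ ⟨$⟩ʳ_) (transpose-fixes e≢e₀ e≢z)) (θ-extends i)
    where
    e≢e₀ : e (suc i) ≢ e zero
    e≢e₀ eq = Finₚ.0≢1+n (sym (e-inj eq))
    e≢z : e (suc i) ≢ z
    e≢z eq = Finₚ.0≢1+n (f-inj (trans (sym (inverseʳ θ)) (trans (cong (θ ⟨$⟩ʳ_) (sym eq)) (θ-extends i))))

injective-covers : ∀ {k} {A : Set} {e h : Fin k → A} → Injective _≡_ _≡_ h →
  (∀ b → ∃ λ c → e c ≡ h b) → ∀ c → ∃ λ b → h b ≡ e c
injective-covers {e = e} {h} h-inj h⊆e c = b , trans (sym (proj₂ (h⊆e b))) (cong e g[b]≡c)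
  where
  g : _ → _
  g b = proj₁ (h⊆e b)
  g-injective : Injective _≡_ _≡_ g
  g-injective {b} {b′} g[b]≡g[b′] =
    h-inj (trans (sym (proj₂ (h⊆e b))) (trans (cong e g[b]≡g[b′]) (proj₂ (h⊆e b′))))
  b = proj₁ (injective⇒surjective g-injective c)
  g[b]≡c = proj₂ (injective⇒surjective g-injective c)

nonzero⇒suc : ∀ {n} {x : Fin (suc n)} → x ≢ zero → ∃ λ k → suc k ≡ x
nonzero⇒suc {x = zero}  x≢0 = contradiction refl x≢0
nonzero⇒suc {x = suc k} _   = k , refl

-- Counting

𝟙 : ∀ {A : Set} → Dec A → ℕ
𝟙 (yes _) = 1
𝟙 (no _)  = 0

𝟙≤1 : ∀ {A : Set} (a : Dec A) → 𝟙 a ≤ 1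
𝟙≤1 (yes _) = ≤-refl
𝟙≤1 (no _)  = z≤n

𝟙≡0⇒¬ : ∀ {A : Set} (a : Dec A) → 𝟙 a ≡ 0 → ¬ A
𝟙≡0⇒¬ (no ¬a) _ = ¬a

𝟙-cong : ∀ {A B : Set} (a : Dec A) (b : Dec B) → A ⇔ B → 𝟙 a ≡ 𝟙 b
𝟙-cong (yes _) (yes _) _   = refl
𝟙-cong (no _)  (no _)  _   = refl
𝟙-cong (yes a) (no ¬b) a⇔b = contradiction (Equivalence.to a⇔b a) ¬b
𝟙-cong (no ¬a) (yes b) a⇔b = contradiction (Equivalence.from a⇔b b) ¬a

𝟙-exclusive : ∀ {A B : Set} (a : Dec A) (b : Dec B) → (A → ¬ B) → 𝟙 a + 𝟙 b ≤ 1
𝟙-exclusive (yes a) (yes b) a⇒¬b = contradiction b (a⇒¬b a)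
𝟙-exclusive (yes _) (no _)  _    = ≤-refl
𝟙-exclusive (no _)  b       _    = 𝟙≤1 b

length-filter≡sum : ∀ {A : Set} {P : A → Set} (P? : ∀ x → Dec (P x)) (xs : List A) →
  length (filter P? xs) ≡ ListAction.sum (List.map (𝟙 ∘ P?) xs)
length-filter≡sum P? []       = refl
length-filter≡sum P? (x ∷ xs) with P? x
... | yes _ = cong suc (length-filter≡sum P? xs)
... | no _  = length-filter≡sum P? xs

sum-split : ∀ m n (f : Fin (m + n) → ℕ) → sum f ≡ sum (f ∘ (_↑ˡ n)) + sum (f ∘ (m ↑ʳ_))
sum-split zero    n f = refl
sum-split (suc m) n f = trans (cong (f zero +_) (sum-split m n (f ∘ suc))) (sym (+-assoc (f zero) _ _))

sum-ones : ∀ n → sum {n} (λ _ → 1) ≡ n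
sum-ones zero    = refl
sum-ones (suc n) = cong suc (sum-ones n)

sum-mono-≤ : ∀ {n} {f g : Fin n → ℕ} → (∀ i → f i ≤ g i) → sum f ≤ sum g
sum-mono-≤ {zero}  f≤g = z≤n
sum-mono-≤ {suc n} f≤g = +-mono-≤ (f≤g zero) (sum-mono-≤ (f≤g ∘ suc))

sum-mono-< : ∀ {n} {f g : Fin n → ℕ} → (∀ i → f i ≤ g i) → ∀ k → f k < g k → sum f < sum g
sum-mono-< f≤g zero    fk<gk = +-mono-<-≤ fk<gk (sum-mono-≤ (f≤g ∘ suc))
sum-mono-< f≤g (suc k) fk<gk = +-mono-≤-< (f≤g zero) (sum-mono-< (f≤g ∘ suc) k fk<gk)

sum-𝟙≡0 : ∀ {n} {P : Fin n → Set} (P? : ∀ x → Dec (P x)) → sum (𝟙 ∘ P?) ≡ 0 → ∀ x → ¬ P x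
sum-𝟙≡0 P? none zero    = 𝟙≡0⇒¬ (P? zero) (m+n≡0⇒m≡0 _ none)
sum-𝟙≡0 P? none (suc x) = sum-𝟙≡0 (P? ∘ suc) (m+n≡0⇒n≡0 (𝟙 (P? zero)) none) x

sum-𝟙≡1⇒unique : ∀ {n} {P : Fin n → Set} (P? : ∀ x → Dec (P x)) → sum (𝟙 ∘ P?) ≡ 1 →
  ∃ λ c → P c × ∀ x → x ≢ c → ¬ P x
sum-𝟙≡1⇒unique {suc n} {P} P? one = split (P? zero) one
  where
  split : (d : Dec (P zero)) → 𝟙 d + sum (𝟙 ∘ P? ∘ suc) ≡ 1 →
          ∃ λ c → P c × ∀ x → x ≢ c → ¬ P x
  split (yes P0) rest≡0 = zero , P0 , λ
    { zero    0≢0 → contradiction refl 0≢0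
    ; (suc x) _   → sum-𝟙≡0 (P? ∘ suc) (suc-injective rest≡0) x }
  split (no ¬P0) rest≡1 with sum-𝟙≡1⇒unique (P? ∘ suc) rest≡1
  ... | c , Pc , unique = suc c , Pc , λ
    { zero    _   → ¬P0
    ; (suc x) x≢c → unique x (x≢c ∘ cong suc) }

-- Sorting

module Sorting {n} {_≺_ : Fin n → Fin n → Set}
  (≺-irrefl : ∀ {x} → ¬ x ≺ x) (≺-trans : ∀ {x y z} → x ≺ y → y ≺ z → x ≺ z)
  (≺-compare : ∀ x y → x ≺ y ⊎ x ≡ y ⊎ y ≺ x) where

  _≺?_ : ∀ x y → Dec (x ≺ y)
  x ≺? y with ≺-compare x y
  ... | inj₁ x≺y         = yes x≺y
  ... | inj₂ (inj₁ refl) = no ≺-irrefl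
  ... | inj₂ (inj₂ y≺x)  = no (λ x≺y → ≺-irrefl (≺-trans x≺y y≺x))

  rank : Fin n → ℕ
  rank x = sum (λ y → 𝟙 (y ≺? x))

  rank<n : ∀ x → rank x < n
  rank<n x = subst (rank x <_) (sum-ones n) (sum-mono-< (λ y → 𝟙≤1 (y ≺? x)) x (x⊀x (x ≺? x)))
    where
    x⊀x : (d : Dec (x ≺ x)) → 𝟙 d < 1
    x⊀x (yes x≺x) = contradiction x≺x ≺-irrefl
    x⊀x (no _)    = s≤s z≤n

  rank-mono : ∀ {x y} → x ≺ y → rank x < rank y
  rank-mono {x} {y} x≺y = sum-mono-< (λ z → pointwise (z ≺? x) (z ≺? y)) x (strict (x ≺? x) (x ≺? y))
    where
    pointwise : ∀ {z} (d : Dec (z ≺ x)) (e : Dec (z ≺ y)) → 𝟙 d ≤ 𝟙 e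
    pointwise (yes z≺x) (no z⊀y) = contradiction (≺-trans z≺x x≺y) z⊀y
    pointwise (yes _)   (yes _)  = ≤-refl
    pointwise (no _)    e        = z≤n
    strict : (d : Dec (x ≺ x)) (e : Dec (x ≺ y)) → 𝟙 d < 𝟙 e
    strict (yes x≺x) _        = contradiction x≺x ≺-irrefl
    strict (no _)    (yes _)  = s≤s z≤n
    strict (no _)    (no x⊀y) = contradiction x≺y x⊀y

  rank-least : ∀ x → (∀ y → y ≢ x → x ≺ y) → rank x ≡ 0
  rank-least x x-least = trans (sum-cong-≗ none) (sum-replicate-zero n)
    where
    none : ∀ y → 𝟙 (y ≺? x) ≡ 0
    none y with y ≺? x
    ... | no _    = refl
    ... | yes y≺x with y Finₚ.≟ x
    ...   | yes refl = contradiction y≺x ≺-irrefl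
    ...   | no y≢x   = contradiction (≺-trans y≺x (x-least y y≢x)) ≺-irrefl

  ranking : Permutation′ n
  ranking = fromInjective (λ x → fromℕ< (rank<n x)) rank-injective
    where
    rank-injective : Injective _≡_ _≡_ (λ x → fromℕ< (rank<n x))
    rank-injective {x} {y} eq with ≺-compare x y
    ... | inj₁ x≺y        = contradiction (Finₚ.fromℕ<-injective _ _ _ _ eq) (<⇒≢ (rank-mono x≺y))
    ... | inj₂ (inj₁ x≡y) = x≡y
    ... | inj₂ (inj₂ y≺x) = contradiction (Finₚ.fromℕ<-injective _ _ _ _ eq) (>⇒≢ (rank-mono y≺x))

  sorting : Permutation′ n
  sorting = flip ranking

  sorting-increasing : ∀ {i j} → toℕ i < toℕ j → (sorting ⟨$⟩ʳ i) ≺ (sorting ⟨$⟩ʳ j)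
  sorting-increasing {i} {j} i<j with ≺-compare (sorting ⟨$⟩ʳ i) (sorting ⟨$⟩ʳ j)
  ... | inj₁ σi≺σj        = σi≺σj
  ... | inj₂ (inj₁ σi≡σj) =
    contradiction (⟨$⟩ʳ-injective sorting σi≡σj) (λ i≡j → <-irrefl (cong toℕ i≡j) i<j)
  ... | inj₂ (inj₂ σj≺σi) = contradiction (rank-mono σj≺σi) (<-asym (subst₂ _<_ (rank-σ i) (rank-σ j) i<j))
    where
    rank-σ : ∀ k → toℕ k ≡ rank (sorting ⟨$⟩ʳ k)
    rank-σ k = trans (cong toℕ (sym (inverseʳ ranking))) (Finₚ.toℕ-fromℕ< _)

  sorting-least : ∀ x → (∀ y → y ≢ x → x ≺ y) → ∀ {i} → toℕ i ≡ 0 → sorting ⟨$⟩ʳ i ≡ x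
  sorting-least x x-least {i} i≡0 = trans (cong (sorting ⟨$⟩ʳ_) i≡rx) (inverseˡ ranking)
    where
    i≡rx : i ≡ ranking ⟨$⟩ʳ x
    i≡rx = Finₚ.toℕ-injective (trans i≡0 (sym (trans (Finₚ.toℕ-fromℕ< _) (rank-least x x-least))))

Lex : ∀ {n m} → (Fin n → Fin m) → (Fin n → Fin m) → Set
Lex r s = ∃ λ k → (∀ j → toℕ j < toℕ k → r j ≡ s j) × toℕ (r k) < toℕ (s k)

lex-irrefl : ∀ {n m} {r : Fin n → Fin m} → ¬ Lex r r
lex-irrefl (_ , _ , rk<rk) = <-irrefl refl rk<rk

lex-trans : ∀ {n m} {r s t : Fin n → Fin m} → Lex r s → Lex s t → Lex r t
lex-trans {r = r} {s} {t} (k , r≡s , rk<sk) (l , s≡t , sl<tl) with <-cmp (toℕ k) (toℕ l)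
... | tri< k<l _ _ =
  k , (λ j j<k → trans (r≡s j j<k) (s≡t j (<-trans j<k k<l))) ,
  subst (λ x → toℕ (r k) < toℕ x) (s≡t k k<l) rk<sk
... | tri≈ _ k≡l _ =
  k , (λ j j<k → trans (r≡s j j<k) (s≡t j (subst (toℕ j <_) k≡l j<k))) ,
  <-trans rk<sk (subst (λ x → toℕ (s x) < toℕ (t x)) (sym (Finₚ.toℕ-injective k≡l)) sl<tl)
... | tri> _ _ l<k =
  l , (λ j j<l → trans (r≡s j (<-trans j<l l<k)) (s≡t j j<l)) ,
  subst (λ x → toℕ x < toℕ (t l)) (sym (r≡s l l<k)) sl<tl

lex-suc : ∀ {n m} {r s : Fin (suc n) → Fin m} → r zero ≡ s zero → Lex (r ∘ suc) (s ∘ suc) → Lex r s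
lex-suc {r = r} {s} r0≡s0 (k , r≡s , rk<sk) = suc k , agree , rk<sk
  where
  agree : ∀ j → toℕ j < toℕ (suc k) → r j ≡ s j
  agree zero    _   = r0≡s0
  agree (suc j) j<k = r≡s j (≤-pred j<k)

lex-compare : ∀ {n m} (r s : Fin n → Fin m) → Lex r s ⊎ (∀ j → r j ≡ s j) ⊎ Lex s r
lex-compare {zero}  r s = inj₂ (inj₁ λ ())
lex-compare {suc n} r s with <-cmp (toℕ (r zero)) (toℕ (s zero))
... | tri< r0<s0 _ _ = inj₁ (zero , (λ _ ()) , r0<s0)
... | tri> _ _ s0<r0 = inj₂ (inj₂ (zero , (λ _ ()) , s0<r0))
... | tri≈ _ r0≡s0 _ with lex-compare (r ∘ suc) (s ∘ suc)
...   | inj₁ r<s        = inj₁ (lex-suc (Finₚ.toℕ-injective r0≡s0) r<s)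
...   | inj₂ (inj₁ r≗s) = inj₂ (inj₁ λ { zero → Finₚ.toℕ-injective r0≡s0 ; (suc j) → r≗s j })
...   | inj₂ (inj₂ s<r) = inj₂ (inj₂ (lex-suc (sym (Finₚ.toℕ-injective r0≡s0)) s<r))

-- Latin squares and isotopy

-- IsLatin and transform of Defs are Latin and isotope at order 10, definitionally.

Sq : ℕ → Set
Sq n = Fin n → Fin n → Fin n

Latin : ∀ {n} → Sq n → Set
Latin A = (∀ i j j′ → A i j ≡ A i j′ → j ≡ j′) × (∀ j i i′ → A i j ≡ A i′ j → i ≡ i′)

isotope : ∀ {n} → Permutation′ n → Permutation′ n → Permutation′ n → Sq n → Sq n
isotope ρ γ π A i j = π ⟨$⟩ʳ A (ρ ⟨$⟩ʳ i) (γ ⟨$⟩ʳ j)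

isotope-latin : ∀ {n} ρ γ π {A : Sq n} → Latin A → Latin (isotope ρ γ π A)
isotope-latin ρ γ π (rows , cols) =
  (λ i j j′ eq → ⟨$⟩ʳ-injective γ (rows _ _ _ (⟨$⟩ʳ-injective π eq))) ,
  (λ j i i′ eq → ⟨$⟩ʳ-injective ρ (cols _ _ _ (⟨$⟩ʳ-injective π eq)))

transposed-latin : ∀ {n} {A : Sq n} → Latin A → Latin (λ i j → A j i)
transposed-latin (rows , cols) = cols , rows

rowPermutation : ∀ {n} {A : Sq n} → Latin A → Fin n → Permutation′ n
rowPermutation {A = A} (rows , _) i = fromInjective (A i) (rows i _ _)

columnPermutation : ∀ {n} {A : Sq n} → Latin A → Fin n → Permutation′ n
columnPermutation {A = A} (_ , cols) j = fromInjective (λ i → A i j) (cols j _ _)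

-- Transporting NormalForm along this equation, rather than relying on the conversion, keeps the
-- type checker from unfolding NormalForm down to the transversal types.
transform-rows : ∀ σ γ π A → transform σ idₚ idₚ (transform idₚ γ π A) ≡ transform σ γ π A
transform-rows σ γ π A = refl

transform-trp : ∀ {A B} ρ ρ′ γ π → IsTRP A B → IsTRP (transform ρ γ π A) (transform ρ′ γ π B)
transform-trp ρ ρ′ γ π trp i i′ j j′ eq eq′ =
  ⟨$⟩ʳ-injective γ (trp _ _ _ _ (⟨$⟩ʳ-injective π eq) (⟨$⟩ʳ-injective π eq′))

-- Sorting the rows of a Latin square into normal-form order

_≺⟨_⟩_ : Fin 10 → Square → Fin 10 → Set
i ≺⟨ A ⟩ i′ = ttype A i < ttype A i′ ⊎ (ttype A i ≡ ttype A i′ × LexLt (A i) (A i′))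

module RowSorting (A : Square) (latin : IsLatin A) where

  ≺-irrefl : ∀ {i} → ¬ i ≺⟨ A ⟩ i
  ≺-irrefl (inj₁ t<t)       = <-irrefl refl t<t
  ≺-irrefl (inj₂ (_ , lex)) = lex-irrefl lex

  ≺-trans : ∀ {i i′ i″} → i ≺⟨ A ⟩ i′ → i′ ≺⟨ A ⟩ i″ → i ≺⟨ A ⟩ i″
  ≺-trans (inj₁ t<t′)         (inj₁ t′<t″)          = inj₁ (<-trans t<t′ t′<t″)
  ≺-trans (inj₁ t<t′)         (inj₂ (t′≡t″ , _))    = inj₁ (subst (_ <_) t′≡t″ t<t′)
  ≺-trans (inj₂ (t≡t′ , _))   (inj₁ t′<t″)          = inj₁ (subst (_< _) (sym t≡t′) t′<t″)
  ≺-trans (inj₂ (t≡t′ , lex)) (inj₂ (t′≡t″ , lex′)) = inj₂ (trans t≡t′ t′≡t″ , lex-trans lex lex′)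

  -- Ties are impossible: distinct rows of a Latin square differ in column 0.
  ≺-compare : ∀ i i′ → i ≺⟨ A ⟩ i′ ⊎ i ≡ i′ ⊎ i′ ≺⟨ A ⟩ i
  ≺-compare i i′ with <-cmp (ttype A i) (ttype A i′)
  ... | tri< t<t′ _ _ = inj₁ (inj₁ t<t′)
  ... | tri> _ _ t′<t = inj₂ (inj₂ (inj₁ t′<t))
  ... | tri≈ _ t≡t′ _ with lex-compare (A i) (A i′)
  ...   | inj₁ lex        = inj₁ (inj₂ (t≡t′ , lex))
  ...   | inj₂ (inj₁ r≗s) = inj₂ (inj₁ (proj₂ latin zero i i′ (r≗s zero)))
  ...   | inj₂ (inj₂ lex) = inj₂ (inj₂ (inj₂ (sym t≡t′ , lex)))

  open Sorting ≺-irrefl ≺-trans ≺-compare public using (sorting; sorting-increasing; sorting-least)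

  sorting-rowsSorted : RowsSorted (transform sorting idₚ idₚ A)
  sorting-rowsSorted i i′ i<i′ = ≺⇒sorted (sorting-increasing i<i′)
    where
    ≺⇒sorted : ∀ {i i′} → i ≺⟨ A ⟩ i′ →
               ttype A i ≤ ttype A i′ × (ttype A i ≡ ttype A i′ → LexLt (A i) (A i′))
    ≺⇒sorted (inj₁ t<t′)         = <⇒≤ t<t′ , λ t≡t′ → contradiction t≡t′ (<⇒≢ t<t′)
    ≺⇒sorted (inj₂ (t≡t′ , lex)) = ≤-reflexive t≡t′ , λ _ → lex

-- The lower-right subsquare of L

White Lower : Fin 10 → Set
White x = toℕ x < 4
Lower x = 6 ≤ toℕ x

white? : ∀ x → Dec (White x)
white? x = toℕ x <? 4

lower? : ∀ x → Dec (Lower x)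
lower? x = 6 ≤? toℕ x

lower⇒↑ʳ : ∀ {x} → Lower x → ∃ λ (a : Fin 4) → 6 ↑ʳ a ≡ x
lower⇒↑ʳ {x} 6≤x with splitView 6 4 x
... | left k  = contradiction (↑ˡ-below 4 k) (≤⇒≯ 6≤x)
... | right a = a , refl

lowerRow-white⇒lower : ∀ {L} → IsLatin L → LowerRightOn0123 L →
  ∀ {r j} → Lower r → White (L r j) → Lower j
lowerRow-white⇒lower {L} (rows , _) subsquare {r} {j} 6≤r Lrj-white with lower⇒↑ʳ 6≤r
... | a , refl = subst Lower (rows (6 ↑ʳ a) (6 ↑ʳ b) j hit) (↑ʳ-notBelow 6 b)
  where
  in-subsquare = injective-covers {e = _↑ˡ 6} {h = λ b → L (6 ↑ʳ a) (6 ↑ʳ b)}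
    (Finₚ.↑ʳ-injective 6 _ _ ∘ rows _ _ _) (below⇒↑ˡ {4} {6} ∘ subsquare a)
    (proj₁ (below⇒↑ˡ {4} {6} Lrj-white))
  b = proj₁ in-subsquare
  hit = trans (proj₂ in-subsquare) (proj₂ (below⇒↑ˡ {4} {6} Lrj-white))

lowerColumn-white⇔lower : ∀ {L} → IsLatin L → LowerRightOn0123 L →
  ∀ {r j} → Lower j → White (L r j) ⇔ Lower r
lowerColumn-white⇔lower {L} latin subsquare {r} {j} 6≤j = mk⇔
  (lowerRow-white⇒lower (transposed-latin latin) (λ a b → subsquare b a) 6≤j)
  (λ 6≤r → in-subsquare (lower⇒↑ʳ 6≤r) (lower⇒↑ʳ 6≤j))
  where
  in-subsquare : ∃ (λ a → 6 ↑ʳ a ≡ r) → ∃ (λ b → 6 ↑ʳ b ≡ j) → White (L r j)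
  in-subsquare (a , refl) (b , refl) = subsquare a b

lowerRight : (L : Square) → LowerRightOn0123 L → Sq 4
lowerRight L subsquare a b = proj₁ (below⇒↑ˡ {4} {6} (subsquare a b))

lowerRight-↑ˡ : ∀ L subsquare a b → lowerRight L subsquare a b ↑ˡ 6 ≡ L (6 ↑ʳ a) (6 ↑ʳ b)
lowerRight-↑ˡ L subsquare a b = proj₂ (below⇒↑ˡ {4} {6} (subsquare a b))

lowerRight-latin : ∀ {L} → IsLatin L → (subsquare : LowerRightOn0123 L) → Latin (lowerRight L subsquare)
lowerRight-latin {L} (rows , cols) subsquare =
  (λ a b b′ eq → Finₚ.↑ʳ-injective 6 _ _ (rows _ _ _ (lift eq))) ,
  (λ b a a′ eq → Finₚ.↑ʳ-injective 6 _ _ (cols _ _ _ (lift eq)))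
  where
  lift : ∀ {a b a′ b′} → lowerRight L subsquare a b ≡ lowerRight L subsquare a′ b′ →
         L (6 ↑ʳ a) (6 ↑ʳ b) ≡ L (6 ↑ʳ a′) (6 ↑ʳ b′)
  lift {a} {b} {a′} {b′} eq =
    trans (sym (lowerRight-↑ˡ L subsquare a b)) (trans (cong (_↑ˡ 6) eq) (lowerRight-↑ˡ L subsquare a′ b′))

ttype≡sum : ∀ P i → ttype P i ≡ sum (λ b → 𝟙 (white? (P i (6 ↑ʳ b))))
ttype≡sum P i = length-filter≡sum (λ b → white? (P i (6 ↑ʳ b))) (List.allFin 4)

-- By the TRP property distinct columns j give distinct rows meet j, so meet is a bijection.
module Meeting {P L : Square} (latinL : IsLatin L) (trp : IsTRP P L) (i : Fin 10) where

  meet : Fin 10 → Fin 10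
  meet j = columnPermutation latinL j ⟨$⟩ˡ P i j

  meet-agrees : ∀ j → L (meet j) j ≡ P i j
  meet-agrees j = inverseʳ (columnPermutation latinL j)

  meeting : Permutation′ 10
  meeting = fromInjective meet meet-injective
    where
    meet-injective : Injective _≡_ _≡_ meet
    meet-injective {j} {j′} eq =
      trp i (meet j) j j′ (sym (meet-agrees j)) (trans (sym (meet-agrees j′)) (cong (λ r → L r j′) (sym eq)))

whites-in-row : ∀ {P} → IsLatin P → ∀ i → sum (λ j → 𝟙 (white? (P i j))) ≡ 4
whites-in-row latin i = sym (∑-permute (𝟙 ∘ white?) (rowPermutation latin i))

whites-in-column : ∀ {P} → IsLatin P → ∀ j → sum (λ i → 𝟙 (white? (P i j))) ≡ 4
whites-in-column latin j = sym (∑-permute (𝟙 ∘ white?) (columnPermutation latin j))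

ttype-positive : ∀ {P L} → IsLatin P → IsLatin L → LowerRightOn0123 L → IsTRP P L →
  ∀ i → 1 ≤ ttype P i
ttype-positive {P} {L} latinP latinL subsquare trp i =
  subst (1 ≤_) (sym (ttype≡sum P i)) (counting {leftSum W} {leftSum H} left-whites left-lowers left-bound)
  where
  open Meeting latinL trp i
  W H : Fin 10 → ℕ
  W j = 𝟙 (white? (P i j))
  H j = 𝟙 (lower? (meet j))

  leftSum rightSum : (Fin 10 → ℕ) → ℕ
  leftSum f  = sum {6} (f ∘ (_↑ˡ 4))
  rightSum f = sum {4} (f ∘ (6 ↑ʳ_))

  left-exclusive : ∀ k → W (k ↑ˡ 4) + H (k ↑ˡ 4) ≤ 1
  left-exclusive k = 𝟙-exclusive (white? _) (lower? _) λ Pij-white meet-lower →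
    contradiction (lowerRow-white⇒lower latinL subsquare meet-lower (subst White (sym (meet-agrees _)) Pij-white))
                  (<⇒≱ (↑ˡ-below 4 k))

  right-agree : ∀ b → W (6 ↑ʳ b) ≡ H (6 ↑ʳ b)
  right-agree b = 𝟙-cong (white? _) (lower? _)
    (subst (λ x → White x ⇔ Lower (meet _)) (meet-agrees _)
           (lowerColumn-white⇔lower latinL subsquare (↑ʳ-notBelow 6 b)))

  left-whites : leftSum W + rightSum W ≡ 4
  left-whites = trans (sym (sum-split 6 4 W)) (whites-in-row latinP i)

  left-lowers : leftSum H + rightSum W ≡ 4
  left-lowers = begin
    leftSum H + rightSum W ≡⟨ cong (leftSum H +_) (sum-cong-≗ right-agree) ⟩
    leftSum H + rightSum H ≡⟨ sum-split 6 4 H ⟨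
    sum H                  ≡⟨ ∑-permute (𝟙 ∘ lower?) meeting ⟨
    4                      ∎
    where open ≡-Reasoning

  left-bound : leftSum W + leftSum H ≤ 6
  left-bound =
    subst (_≤ 6) (∑-distrib-+ {6} (W ∘ (_↑ˡ 4)) (H ∘ (_↑ˡ 4))) (sum-mono-≤ {g = λ _ → 1} left-exclusive)

  counting : ∀ {x y k} → x + k ≡ 4 → y + k ≡ 4 → x + y ≤ 6 → 1 ≤ k
  counting {k = suc _} _ _ _ = s≤s z≤n
  counting {x} {y} {zero} x≡4 y≡4 x+y≤6 = contradiction
    (subst₂ (λ x y → x + y ≤ 6) (trans (sym (+-identityʳ x)) x≡4) (trans (sym (+-identityʳ y)) y≡4) x+y≤6)
    (from-no (8 ≤? 6))

ttype-total : ∀ {P} → IsLatin P → sum (ttype P) ≡ 16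
ttype-total {P} latin = begin
  sum (ttype P)                                      ≡⟨ sum-cong-≗ (ttype≡sum P) ⟩
  sum (λ i → sum (λ b → 𝟙 (white? (P i (6 ↑ʳ b)))))  ≡⟨ ∑-comm (λ i b → 𝟙 (white? (P i (6 ↑ʳ b)))) ⟩
  sum (λ b → sum (λ i → 𝟙 (white? (P i (6 ↑ʳ b)))))  ≡⟨ sum-cong-≗ (whites-in-column latin ∘ (6 ↑ʳ_)) ⟩
  16                                                 ∎
  where open ≡-Reasoning

-- Ten rows of type ≥ 1 sharing only 16 white cells cannot all have type ≥ 2.
ttype-one-exists : ∀ {P L} → IsLatin P → IsLatin L → LowerRightOn0123 L → IsTRP P L →
  ∃ λ i → ttype P i ≡ 1
ttype-one-exists {P} latinP latinL subsquare trp with Finₚ.any? (λ i → ttype P i ≟ 1)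
... | yes found = found
... | no none   = contradiction (subst (20 ≤_) (ttype-total latinP) (sum-mono-≤ {f = λ _ → 2} at-least-two))
                                (from-no (20 ≤? 16))
  where
  at-least-two : ∀ i → 2 ≤ ttype P i
  at-least-two i = ≤∧≢⇒< (ttype-positive latinP latinL subsquare trp i) (λ 1≡t → none (i , sym 1≡t))

ttype-one-row : ∀ {P L} → IsLatin P → IsLatin L → LowerRightOn0123 L → IsTRP P L →
  ∃ λ R → ∃₂ λ c s → s ↑ˡ 6 ≡ P R (6 ↑ʳ c) × ∀ b → b ≢ c → ¬ White (P R (6 ↑ʳ b))
ttype-one-row {P} latinP latinL subsquare trp =
  R , c , proj₁ (below⇒↑ˡ {4} {6} c-white) , proj₂ (below⇒↑ˡ {4} {6} c-white) , others-nonwhite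
  where
  type-one = ttype-one-exists latinP latinL subsquare trp
  R = proj₁ type-one
  unique = sum-𝟙≡1⇒unique (λ b → white? (P R (6 ↑ʳ b))) (trans (sym (ttype≡sum P R)) (proj₂ type-one))
  c = proj₁ unique
  c-white = proj₁ (proj₂ unique)
  others-nonwhite = proj₂ (proj₂ unique)

-- Latin squares of order 4

table : ∀ {n} → Vec (Vec (Fin n) n) n → Sq n
table T a b = lookup (lookup T a) b

_≗₂_ : ∀ {n} → Sq n → Sq n → Set
S ≗₂ T = ∀ a b → S a b ≡ T a b

_≗₂?_ : ∀ {n} (S T : Sq n) → Dec (S ≗₂ T)
S ≗₂? T = Finₚ.all? λ a → Finₚ.all? λ b → S a b Finₚ.≟ T a b

isotope-cong : ∀ {n} ρ γ π {S T : Sq n} → S ≗₂ T → isotope ρ γ π S ≗₂ isotope ρ γ π T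
isotope-cong ρ γ π S≗T a b = cong (π ⟨$⟩ʳ_) (S≗T _ _)

Reduced : ∀ {n} → Sq (suc n) → Set
Reduced S = (∀ b → S zero b ≡ b) × (∀ a → S a zero ≡ a)

ω₁ ω₂ ω₃ ω₄ : Sq 4
ω₁ = table ((0F ∷ 1F ∷ 2F ∷ 3F ∷ []) ∷
            (1F ∷ 2F ∷ 3F ∷ 0F ∷ []) ∷
            (2F ∷ 3F ∷ 0F ∷ 1F ∷ []) ∷
            (3F ∷ 0F ∷ 1F ∷ 2F ∷ []) ∷ [])
ω₂ = table ((0F ∷ 1F ∷ 2F ∷ 3F ∷ []) ∷
            (1F ∷ 0F ∷ 3F ∷ 2F ∷ []) ∷
            (2F ∷ 3F ∷ 0F ∷ 1F ∷ []) ∷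
            (3F ∷ 2F ∷ 1F ∷ 0F ∷ []) ∷ [])
ω₃ = table ((0F ∷ 1F ∷ 2F ∷ 3F ∷ []) ∷
            (1F ∷ 0F ∷ 3F ∷ 2F ∷ []) ∷
            (2F ∷ 3F ∷ 1F ∷ 0F ∷ []) ∷
            (3F ∷ 2F ∷ 0F ∷ 1F ∷ []) ∷ [])
ω₄ = table ((0F ∷ 1F ∷ 2F ∷ 3F ∷ []) ∷
            (1F ∷ 3F ∷ 0F ∷ 2F ∷ []) ∷
            (2F ∷ 0F ∷ 3F ∷ 1F ∷ []) ∷
            (3F ∷ 2F ∷ 1F ∷ 0F ∷ []) ∷ [])

ReducedOrder4 : Sq 4 → Set
ReducedOrder4 S = S ≗₂ ω₁ ⊎ S ≗₂ ω₂ ⊎ S ≗₂ ω₃ ⊎ S ≗₂ ω₄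

reducedOrder4? : ∀ S → Dec (ReducedOrder4 S)
reducedOrder4? S = S ≗₂? ω₁ ⊎-dec S ≗₂? ω₂ ⊎-dec S ≗₂? ω₃ ⊎-dec S ≗₂? ω₄

CellPair : Set
CellPair = (Fin 4 × Fin 4) × (Fin 4 × Fin 4)

Aligned : CellPair → Set
Aligned ((a , b) , (a′ , b′)) = (a ≡ a′ × b ≢ b′) ⊎ (b ≡ b′ × a ≢ a′)

aligned? : ∀ p → Dec (Aligned p)
aligned? ((a , b) , (a′ , b′)) =
  ((a Finₚ.≟ a′) ×-dec ¬? (b Finₚ.≟ b′)) ⊎-dec ((b Finₚ.≟ b′) ×-dec ¬? (a Finₚ.≟ a′))

Separates : Sq 4 → CellPair → Set
Separates S ((a , b) , (a′ , b′)) = S a b ≢ S a′ b′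

separates? : ∀ S p → Dec (Separates S p)
separates? S ((a , b) , (a′ , b′)) = ¬? (S a b Finₚ.≟ S a′ b′)

latin-separates : ∀ {S} → Latin S → ∀ {p} → Aligned p → Separates S p
latin-separates (rows , _) (inj₁ (refl , b≢b′)) eq = b≢b′ (rows _ _ _ eq)
latin-separates (_ , cols) (inj₂ (refl , a≢a′)) eq = a≢a′ (cols _ _ _ eq)

-- Defined by recursion rather than with All, so that Separated S ps reduces to a product of concrete
-- inequalities as soon as ps is a concrete list.
Separated : Sq 4 → List CellPair → Set
Separated S []       = ⊤
Separated S (p ∷ ps) = Separates S p × Separated S ps

separated? : ∀ S ps → Dec (Separated S ps)
separated? S []       = yes tt
separated? S (p ∷ ps) = separates? S p ×-dec separated? S ps

latin-separated : ∀ {S T} → Latin S → S ≗₂ T → ∀ {ps} → All Aligned ps → Separated T ps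
latin-separated latin S≗T All.[]                   = tt
latin-separated {S} {T} latin S≗T (aligned All.∷ aligneds) =
  separates-cong (latin-separates latin aligned) , latin-separated latin S≗T aligneds
  where
  separates-cong : ∀ {p} → Separates S p → Separates T p
  separates-cong {(a , b) , (a′ , b′)} sep eq = sep (trans (S≗T a b) (trans eq (sym (S≗T a′ b′))))

-- The pairs of cells that row a of a reduced Latin square must keep apart: any two cells of the row,
-- and each of its cells in columns 1–3 from the cell above it in an earlier row.
newPairs : Fin 4 → List CellPair
newPairs a = List.concatMap withinRow (List.allFin 4) List.++ List.concatMap withRow above
  where
  withinRow : Fin 4 → List CellPair
  withinRow b = List.map (λ b′ → (a , b) , (a , b′)) (List.filter (λ b′ → toℕ b <? toℕ b′) (List.allFin 4))
  above = List.filter (λ a′ → toℕ a′ <? toℕ a) (List.allFin 4)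
  withRow : Fin 4 → List CellPair
  withRow a′ = List.map (λ b → (a , b) , (a′ , b)) (1F ∷ 2F ∷ 3F ∷ [])

completion : Vec (Vec (Fin 4) 3) 3 → Sq 4
completion inner zero    b       = b
completion inner (suc a) zero    = suc a
completion inner (suc a) (suc b) = lookup (lookup inner a) b

inner : Sq 4 → Vec (Vec (Fin 4) 3) 3
inner S = Vec.tabulate λ a → Vec.tabulate λ b → S (suc a) (suc b)

reduced≗completion : ∀ {S} → Reduced S → S ≗₂ completion (inner S)
reduced≗completion (row₀ , _)    zero    b       = row₀ b
reduced≗completion (_    , col₀) (suc a) zero    = col₀ (suc a)
reduced≗completion {S} _         (suc a) (suc b) =
  sym (trans (cong (λ row → lookup row b) (Vecₚ.lookup∘tabulate (λ a → Vec.tabulate (S (suc a) ∘ suc)) a))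
             (Vecₚ.lookup∘tabulate (S (suc a) ∘ suc) b))

candidate : (x y z p q r u v w : Fin 4) → Sq 4
candidate x y z p q r u v w = completion ((x ∷ y ∷ z ∷ []) ∷ (p ∷ q ∷ r ∷ []) ∷ (u ∷ v ∷ w ∷ []) ∷ [])

-- Row by row search over the 4⁹ candidates; the zeros stand for rows not filled in yet.
opaque
  candidates-classified :
    ∀ x y z → Separated (candidate x y z 0F 0F 0F 0F 0F 0F) (newPairs 1F) →
    ∀ p q r → Separated (candidate x y z p q r 0F 0F 0F) (newPairs 2F) →
    ∀ u v w → Separated (candidate x y z p q r u v w) (newPairs 3F) →
    ReducedOrder4 (candidate x y z p q r u v w)
  candidates-classified = from-yes
    (Finₚ.all? λ x → Finₚ.all? λ y → Finₚ.all? λ z →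
       separated? (candidate x y z 0F 0F 0F 0F 0F 0F) (newPairs 1F) →-dec
    (Finₚ.all? λ p → Finₚ.all? λ q → Finₚ.all? λ r →
       separated? (candidate x y z p q r 0F 0F 0F) (newPairs 2F) →-dec
    (Finₚ.all? λ u → Finₚ.all? λ v → Finₚ.all? λ w →
       separated? (candidate x y z p q r u v w) (newPairs 3F) →-dec
    reducedOrder4? (candidate x y z p q r u v w))))

reduced-classification : ∀ {S} → Latin S → Reduced S → ReducedOrder4 S
reduced-classification {S} latin reduced =
  Sum.map (transport ω₁) (Sum.map (transport ω₂) (Sum.map (transport ω₃) (transport ω₄)))
    (candidates-classified
      (S 1F 1F) (S 1F 2F) (S 1F 3F) (separated (newPairs 1F))
      (S 2F 1F) (S 2F 2F) (S 2F 3F) (separated (newPairs 2F))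
      (S 3F 1F) (S 3F 2F) (S 3F 3F) (separated (newPairs 3F)))
  where
  S≗C = reduced≗completion reduced
  separated : ∀ ps → {True (all? aligned? ps)} → Separated (completion (inner S)) ps
  separated ps {aligned} = latin-separated latin S≗C (toWitness aligned)
  transport : ∀ ω → completion (inner S) ≗₂ ω → S ≗₂ ω
  transport ω C≗ω a b = trans (S≗C a b) (C≗ω a b)

IsotopicToΩ : Permutation′ 4 → Permutation′ 4 → Permutation′ 4 → Sq 4 → Set
IsotopicToΩ α β δ S = isotope α β δ S ≗₂ ω₁ ⊎ isotope α β δ S ≗₂ ω₂

reduced-isomorphic : ∀ {S} → Latin S → Reduced S → ∃ λ φ → φ ⟨$⟩ʳ 0F ≡ 0F × IsotopicToΩ φ φ φ S
reduced-isomorphic {S} latin reduced = isomorphic (reduced-classification latin reduced)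
  where
  conjugate : ∀ φ {ω} → φ ⟨$⟩ʳ 0F ≡ 0F → S ≗₂ ω → {True (isotope φ φ φ ω ≗₂? ω₁)} →
              ∃ λ φ → φ ⟨$⟩ʳ 0F ≡ 0F × IsotopicToΩ φ φ φ S
  conjugate φ φ0≡0 S≗ω {φωφ≗ω₁} =
    φ , φ0≡0 , inj₁ λ a b → trans (isotope-cong φ φ φ S≗ω a b) (toWitness φωφ≗ω₁ a b)

  isomorphic : ReducedOrder4 S → ∃ λ φ → φ ⟨$⟩ʳ 0F ≡ 0F × IsotopicToΩ φ φ φ S
  isomorphic (inj₁ S≗ω₁)               = idₚ , refl , inj₁ S≗ω₁
  isomorphic (inj₂ (inj₁ S≗ω₂))        = idₚ , refl , inj₂ S≗ω₂
  isomorphic (inj₂ (inj₂ (inj₁ S≗ω₃))) = conjugate (transpose 1F 2F) refl S≗ω₃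
  isomorphic (inj₂ (inj₂ (inj₂ S≗ω₄))) = conjugate (transpose 2F 3F) refl S≗ω₄

-- Bring row a₀ to the top and column c to the left, then rename symbols so the first row reads 0, 1, ….
reduced-isotope : ∀ {n} {S : Sq (suc n)} → Latin S → ∀ a₀ c →
  ∃₂ λ α β → ∃ λ δ → β ⟨$⟩ʳ zero ≡ c × δ ⟨$⟩ʳ S a₀ c ≡ zero × Reduced (isotope α β δ S)
reduced-isotope {S = S} latin a₀ c = α , β , δ , refl , inverseˡ row₀ , first-row , first-column
  where
  β : Permutation′ _
  β = transpose zero c
  row₀ column : Permutation′ _
  row₀   = fromInjective (λ b → S a₀ (β ⟨$⟩ʳ b)) (⟨$⟩ʳ-injective β ∘ proj₁ latin a₀ _ _)
  column = columnPermutation latin c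
  α δ : Permutation′ _
  α = row₀ ∘ₚ flip column
  δ = flip row₀
  first-row : ∀ b → δ ⟨$⟩ʳ S (α ⟨$⟩ʳ zero) (β ⟨$⟩ʳ b) ≡ b
  first-row b = trans (cong (λ a → δ ⟨$⟩ʳ S a (β ⟨$⟩ʳ b)) (inverseˡ column)) (inverseˡ row₀)
  first-column : ∀ a → δ ⟨$⟩ʳ S (α ⟨$⟩ʳ a) c ≡ a
  first-column a = trans (cong (δ ⟨$⟩ʳ_) (inverseʳ column)) (inverseˡ row₀)

avoiding-row : ∀ {n} {S : Sq (suc (suc n))} → Latin S → ∀ c s → ∃ λ a → S a c ≢ s
avoiding-row {S = S} (_ , cols) c s with S zero c Finₚ.≟ s
... | yes S0c≡s = suc zero , λ S1c≡s → contradiction (cols c _ _ (trans S1c≡s (sym S0c≡s))) λ ()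
... | no S0c≢s  = zero , S0c≢s

subsquare-normalisation : ∀ {S : Sq 4} → Latin S → ∀ c s →
  ∃₂ λ α β → ∃ λ δ → β ⟨$⟩ʳ 0F ≡ c × δ ⟨$⟩ʳ s ≢ 0F × IsotopicToΩ α β δ S
subsquare-normalisation {S} latin c s with avoiding-row latin c s
... | a₀ , Sa₀c≢s with reduced-isotope latin a₀ c
...   | α₀ , β₀ , δ₀ , β₀0≡c , δ₀Sa₀c≡0 , reduced
        with reduced-isomorphic (isotope-latin α₀ β₀ δ₀ latin) reduced
...     | φ , φ0≡0 , isotopic =
  φ ∘ₚ α₀ , φ ∘ₚ β₀ , δ₀ ∘ₚ φ , trans (cong (β₀ ⟨$⟩ʳ_) φ0≡0) β₀0≡c , δs≢0 , isotopic
  where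
  δs≢0 : φ ⟨$⟩ʳ (δ₀ ⟨$⟩ʳ s) ≢ 0F
  δs≢0 φδ₀s≡0 =
    Sa₀c≢s (⟨$⟩ʳ-injective δ₀ (trans δ₀Sa₀c≡0 (sym (⟨$⟩ʳ-injective φ (trans φδ₀s≡0 (sym φ0≡0))))))

-- The first rows of the normal form

normalRow : Fin 3 → Vec (Fin 10) 10
normalRow 0F = row₃
normalRow 1F = row₂
normalRow 2F = row₁

FirstRowOfNormalForm : (Fin 10 → Fin 10) → Set
FirstRowOfNormalForm r =
  (∀ j → r j ≡ lookup row₁ j) ⊎ (∀ j → r j ≡ lookup row₂ j) ⊎ (∀ j → r j ≡ lookup row₃ j)

firstRow-cong : ∀ {r s} → (∀ j → r j ≡ s j) → FirstRowOfNormalForm s → FirstRowOfNormalForm r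
firstRow-cong {r} {s} r≗s = Sum.map then (Sum.map then then)
  where
  then : ∀ {t : Fin 10 → Fin 10} → (∀ j → s j ≡ t j) → ∀ j → r j ≡ t j
  then s≗t j = trans (r≗s j) (s≗t j)

normalRow-first : ∀ k → FirstRowOfNormalForm (lookup (normalRow k))
normalRow-first 0F = inj₂ (inj₂ λ _ → refl)
normalRow-first 1F = inj₂ (inj₁ λ _ → refl)
normalRow-first 2F = inj₁ λ _ → refl

normalRow-column₀ : ∀ k → lookup (normalRow k) (# 0) ≡ # 0
normalRow-column₀ 0F = refl
normalRow-column₀ 1F = refl
normalRow-column₀ 2F = refl

normalRow-column₆ : ∀ k → lookup (normalRow k) (# 6) ≡ suc k ↑ˡ 6
normalRow-column₆ 0F = refl
normalRow-column₆ 1F = refl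
normalRow-column₆ 2F = refl

normalRow-ttype : ∀ k → sum (λ b → 𝟙 (white? (lookup (normalRow k) (6 ↑ʳ b)))) ≡ 1
normalRow-ttype 0F = refl
normalRow-ttype 1F = refl
normalRow-ttype 2F = refl

opaque
  normalRow-injective : ∀ k → Injective _≡_ _≡_ (lookup (normalRow k))
  normalRow-injective k {j} {j′} = from-yes
    (Finₚ.all? λ k → Finₚ.all? λ j → Finₚ.all? λ j′ →
       (lookup (normalRow k) j Finₚ.≟ lookup (normalRow k) j′) →-dec (j Finₚ.≟ j′)) k j j′

WhiteColumn : Fin 10 → Set
WhiteColumn j = (∃ λ (i : Fin 3) → (i ↑ˡ 3) ↑ˡ 4 ≡ j) ⊎ j ≡ # 6

whiteColumn? : ∀ j → Dec (WhiteColumn j)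
whiteColumn? j = Finₚ.any? (λ i → (i ↑ˡ 3) ↑ˡ 4 Finₚ.≟ j) ⊎-dec (j Finₚ.≟ # 6)

opaque
  normalRow-white⇔ : ∀ k j → White (lookup (normalRow k) j) ⇔ WhiteColumn j
  normalRow-white⇔ k j = mk⇔ (proj₁ (white-pattern k j)) (proj₂ (white-pattern k j))
    where
    white-pattern : ∀ k j → (White (lookup (normalRow k) j) → WhiteColumn j) ×
                            (WhiteColumn j → White (lookup (normalRow k) j))
    white-pattern = from-yes (Finₚ.all? λ k → Finₚ.all? λ j →
      (white? (lookup (normalRow k) j) →-dec whiteColumn? j) ×-dec
      (whiteColumn? j →-dec white? (lookup (normalRow k) j)))

-- Move the white symbols other than r 6 into columns 0, 1, 2 in the order of the normal row, then
-- rename the remaining, non-white, symbols.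
row-normalisation : ∀ {r : Fin 10 → Fin 10} → Injective _≡_ _≡_ r → ∀ k →
  r (# 6) ≡ suc k ↑ˡ 6 → (∀ b → b ≢ 0F → ¬ White (r (6 ↑ʳ b))) →
  ∃₂ λ (θ : Permutation′ 6) (π : Permutation′ 10) →
    (∀ x → White x → π ⟨$⟩ʳ x ≡ x) ×
    (∀ j → π ⟨$⟩ʳ r ((θ ⊕ idₚ) ⟨$⟩ʳ j) ≡ lookup (normalRow k) j)
row-normalisation {r} r-injective k r₆≡k right-nonwhite = θ , π , π-fixes-whites , π-normalises
  where
  t = lookup (normalRow k)
  ρ = fromInjective r r-injective
  t-white : ∀ i → White (t ((i ↑ˡ 3) ↑ˡ 4))
  t-white i = Equivalence.from (normalRow-white⇔ k _) (inj₁ (i , refl))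

  left-of-6 : ∀ {j} i → r j ≡ t ((i ↑ˡ 3) ↑ˡ 4) → toℕ j < 6
  left-of-6 {j} i rj≡ti with splitView 6 4 j
  ... | left p        = ↑ˡ-below 4 p
  ... | right 0F      = contradiction (normalRow-injective k (trans (normalRow-column₆ k) (trans (sym r₆≡k) rj≡ti)))
                                      (λ 6≡i → <-irrefl (cong toℕ (sym 6≡i)) (↑ˡ-below 4 (i ↑ˡ 3)))
  ... | right (suc b) = contradiction (subst White (sym rj≡ti) (t-white i)) (right-nonwhite (suc b) λ ())

  position : ∀ i → ∃ λ p → p ↑ˡ 4 ≡ ρ ⟨$⟩ˡ t ((i ↑ˡ 3) ↑ˡ 4)
  position i = below⇒↑ˡ {6} {4} (left-of-6 i (inverseʳ ρ))
  pos : Fin 3 → Fin 6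
  pos i = proj₁ (position i)
  pos-spec : ∀ i → r (pos i ↑ˡ 4) ≡ t ((i ↑ˡ 3) ↑ˡ 4)
  pos-spec i = trans (cong r (proj₂ (position i))) (inverseʳ ρ)
  pos-injective : Injective _≡_ _≡_ pos
  pos-injective {i} {i′} eq = Finₚ.↑ˡ-injective 3 i i′ (Finₚ.↑ˡ-injective 4 _ _
    (normalRow-injective k (trans (sym (pos-spec i)) (trans (cong (λ p → r (p ↑ˡ 4)) eq) (pos-spec i′)))))

  extension = injection-extends {e = _↑ˡ 3} (Finₚ.↑ˡ-injective 3 _ _) pos-injective
  θ = proj₁ extension

  r′ : Fin 10 → Fin 10
  r′ j = r ((θ ⊕ idₚ) ⟨$⟩ʳ j)
  r′-injective : Injective _≡_ _≡_ r′
  r′-injective = ⟨$⟩ʳ-injective (θ ⊕ idₚ) ∘ r-injective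

  r′-agrees : ∀ j → WhiteColumn j → r′ j ≡ t j
  r′-agrees _ (inj₁ (i , refl)) =
    trans (cong r (trans (⊕-↑ˡ θ idₚ (i ↑ˡ 3)) (cong (_↑ˡ 4) (proj₂ extension i)))) (pos-spec i)
  r′-agrees _ (inj₂ refl) = trans r₆≡k (sym (normalRow-column₆ k))

  τ : Permutation′ 10
  τ = fromInjective t (normalRow-injective k)
  π : Permutation′ 10
  π = flip (fromInjective r′ r′-injective) ∘ₚ τ

  π-normalises : ∀ j → π ⟨$⟩ʳ r′ j ≡ t j
  π-normalises j = cong t (inverseˡ (fromInjective r′ r′-injective))

  π-fixes-whites : ∀ x → White x → π ⟨$⟩ʳ x ≡ x
  π-fixes-whites x x-white = begin
    π ⟨$⟩ʳ x     ≡⟨ cong (π ⟨$⟩ʳ_) (inverseʳ τ) ⟨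
    π ⟨$⟩ʳ t j   ≡⟨ cong (π ⟨$⟩ʳ_) (r′-agrees j (Equivalence.to (normalRow-white⇔ k j) tj-white)) ⟨
    π ⟨$⟩ʳ r′ j  ≡⟨ π-normalises j ⟩
    t j          ≡⟨ inverseʳ τ ⟩
    x            ∎
    where
    open ≡-Reasoning
    j = τ ⟨$⟩ˡ x
    tj-white = subst White (sym (inverseʳ τ)) x-white

-- Colours

<ᵇ≡true : ∀ {m n} → m < n → (m <ᵇ n) ≡ true
<ᵇ≡true m<n = Equivalence.to Boolₚ.T-≡ (<⇒<ᵇ m<n)

<ᵇ≡false : ∀ {m n} → ¬ m < n → (m <ᵇ n) ≡ false
<ᵇ≡false {m} {n} m≮n with m <ᵇ n in eq
... | false = refl
... | true  = contradiction (<ᵇ⇒< m n (Equivalence.from Boolₚ.T-≡ eq)) m≮n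

colourL-white : ∀ L {r j} → White (L r j) → colourL L r j ≡ white
colourL-white L Lrj-white rewrite <ᵇ≡true Lrj-white = refl

colourL-light : ∀ L {r j} → ¬ White (L r j) → Lower r ⊎ Lower j → colourL L r j ≡ light
colourL-light L {r} {j} nonwhite lower rewrite <ᵇ≡false nonwhite with lower
... | inj₁ 6≤r rewrite <ᵇ≡false (≤⇒≯ 6≤r)                             = refl
... | inj₂ 6≤j rewrite <ᵇ≡false (≤⇒≯ 6≤j) | Boolₚ.∧-zeroʳ (toℕ r <ᵇ 6) = refl

hasColour-white : ∀ {L P} → IsLatin L → ∀ {i j} → White (P i j) → HasColour L P i j white
hasColour-white {L} {P} latinL {i} {j} Pij-white =
  r , Lrj≡Pij , colourL-white L (subst White (sym Lrj≡Pij) Pij-white)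
  where
  r = columnPermutation latinL j ⟨$⟩ˡ P i j
  Lrj≡Pij = inverseʳ (columnPermutation latinL j)

hasColour-light : ∀ {L P i j r} → L r j ≡ P i j → ¬ White (P i j) → Lower r ⊎ Lower j →
  HasColour L P i j light
hasColour-light {L} {r = r} Lrj≡Pij nonwhite lower =
  r , Lrj≡Pij , colourL-light L (nonwhite ∘ subst White Lrj≡Pij) lower

meetColumn : Fin 4 → Fin 10
meetColumn = lookup (# 3 ∷ # 4 ∷ # 5 ∷ # 6 ∷ [])

-- A lower row of L meets a normal first row of P in a column that is white exactly when it is lower,
-- i.e. in column 3, 4, 5 or 6; the four lower rows meet it in four distinct columns, so in all of them.
lowerRows-meet-normalRow : ∀ {L P} → IsLatin L → LowerRightOn0123 L → IsTRP P L →
  ∀ k → (∀ j → P zero j ≡ lookup (normalRow k) j) →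
  ∀ c → ∃ λ r → Lower r × L r (meetColumn c) ≡ P zero (meetColumn c)
lowerRows-meet-normalRow {L} {P} latinL subsquare trp k P0≡t c =
  6 ↑ʳ a , ↑ʳ-notBelow 6 a , subst (λ j → L (6 ↑ʳ a) j ≡ P zero j) (proj₂ covered) (meets a)
  where
  open Meeting latinL trp zero
  g : Fin 4 → Fin 10
  g a = meeting ⟨$⟩ˡ (6 ↑ʳ a)
  g-injective : Injective _≡_ _≡_ g
  g-injective = Finₚ.↑ʳ-injective 6 _ _ ∘ ⟨$⟩ʳ-injective (flip meeting)
  meets : ∀ a → L (6 ↑ʳ a) (g a) ≡ P zero (g a)
  meets a = subst (λ r → L r (g a) ≡ P zero (g a)) (inverseʳ meeting) (meet-agrees (g a))

  columns : ∀ j → (WhiteColumn j → Lower j) → (Lower j → WhiteColumn j) → ∃ λ c → meetColumn c ≡ j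
  columns = from-yes (Finₚ.all? λ j →
    (whiteColumn? j →-dec lower? j) →-dec (lower? j →-dec whiteColumn? j) →-dec
    Finₚ.any? (λ c → meetColumn c Finₚ.≟ j))

  g-meetColumn : ∀ a → ∃ λ c → meetColumn c ≡ g a
  g-meetColumn a = columns (g a) whiteColumn⇒lower lower⇒whiteColumn
    where
    white⇔whiteColumn : White (L (6 ↑ʳ a) (g a)) ⇔ WhiteColumn (g a)
    white⇔whiteColumn = subst (λ x → White x ⇔ WhiteColumn (g a)) (sym (trans (meets a) (P0≡t (g a))))
                              (normalRow-white⇔ k (g a))
    whiteColumn⇒lower : WhiteColumn (g a) → Lower (g a)
    whiteColumn⇒lower =
      lowerRow-white⇒lower latinL subsquare (↑ʳ-notBelow 6 a) ∘ Equivalence.from white⇔whiteColumn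
    lower⇒whiteColumn : Lower (g a) → WhiteColumn (g a)
    lower⇒whiteColumn ga-lower = Equivalence.to white⇔whiteColumn
      (Equivalence.from (lowerColumn-white⇔lower latinL subsquare ga-lower) (↑ʳ-notBelow 6 a))

  covered = injective-covers g-injective g-meetColumn c
  a = proj₁ covered

FirstRowColoured : Square → Square → Set
FirstRowColoured L P =
  HasColour L P zero (# 0) white × HasColour L P zero (# 1) white ×
  HasColour L P zero (# 2) white × HasColour L P zero (# 6) white ×
  HasColour L P zero (# 3) light × HasColour L P zero (# 4) light ×
  HasColour L P zero (# 5) light × HasColour L P zero (# 7) light ×
  HasColour L P zero (# 8) light × HasColour L P zero (# 9) light

normalRow-coloured : ∀ {L P} → IsLatin L → LowerRightOn0123 L → IsTRP P L →
  ∀ k → (∀ j → P zero j ≡ lookup (normalRow k) j) → FirstRowColoured L P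
normalRow-coloured {L} {P} latinL subsquare trp k P0≡t =
  white-at (inj₁ (0F , refl)) , white-at (inj₁ (1F , refl)) , white-at (inj₁ (2F , refl)) , white-at (inj₂ refl) ,
  light-meet 0F , light-meet 1F , light-meet 2F , light-right (# 7) , light-right (# 8) , light-right (# 9)
  where
  P0-white⇔ : ∀ j → White (P zero j) ⇔ WhiteColumn j
  P0-white⇔ j = subst (λ x → White x ⇔ WhiteColumn j) (sym (P0≡t j)) (normalRow-white⇔ k j)

  white-at : ∀ {j} → WhiteColumn j → HasColour L P zero j white
  white-at {j} = hasColour-white {L} {P} latinL {zero} {j} ∘ Equivalence.from (P0-white⇔ j)

  nonwhite-at : ∀ j → {False (whiteColumn? j)} → ¬ White (P zero j)
  nonwhite-at j {not-white-column} = toWitnessFalse not-white-column ∘ Equivalence.to (P0-white⇔ j)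

  light-meet : ∀ c → {False (whiteColumn? (meetColumn c))} → HasColour L P zero (meetColumn c) light
  light-meet c {not-white-column} =
    hasColour-light {L} {P} Lrj≡P0j (nonwhite-at _ {not-white-column}) (inj₁ r-lower)
    where
    meeting = lowerRows-meet-normalRow latinL subsquare trp k P0≡t c
    r-lower = proj₁ (proj₂ meeting)
    Lrj≡P0j = proj₂ (proj₂ meeting)

  light-right : ∀ j → {False (whiteColumn? j)} → {True (lower? j)} → HasColour L P zero j light
  light-right j {not-white-column} {lower} =
    hasColour-light {L} {P} (inverseʳ (columnPermutation latinL j)) (nonwhite-at j {not-white-column})
                    (inj₂ (toWitness lower))

-- Normalising (P, Q) and L

Ω₁≡ω₁ : ∀ a b → lookup (lookup Ω₁ a) b ≡ ω₁ a b ↑ˡ 6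
Ω₁≡ω₁ = from-yes (Finₚ.all? λ a → Finₚ.all? λ b → lookup (lookup Ω₁ a) b Finₚ.≟ ω₁ a b ↑ˡ 6)

Ω₂≡ω₂ : ∀ a b → lookup (lookup Ω₂ a) b ≡ ω₂ a b ↑ˡ 6
Ω₂≡ω₂ = from-yes (Finₚ.all? λ a → Finₚ.all? λ b → lookup (lookup Ω₂ a) b Finₚ.≟ ω₂ a b ↑ˡ 6)

subsquareIs⇒lowerRightOn0123 : ∀ {L} → SubsquareIs L Ω₁ ⊎ SubsquareIs L Ω₂ → LowerRightOn0123 L
subsquareIs⇒lowerRightOn0123 (inj₁ L≡Ω₁) a b =
  subst White (sym (trans (L≡Ω₁ a b) (Ω₁≡ω₁ a b))) (↑ˡ-below 6 _)
subsquareIs⇒lowerRightOn0123 (inj₂ L≡Ω₂) a b =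
  subst White (sym (trans (L≡Ω₂ a b) (Ω₂≡ω₂ a b))) (↑ˡ-below 6 _)

module NormalisingIsotopy
  {L P : Square} (latinL : IsLatin L) (subsquare : LowerRightOn0123 L) (latinP : IsLatin P)
  (R : Fin 10) (c s : Fin 4) (s≡PRc : s ↑ˡ 6 ≡ P R (6 ↑ʳ c))
  (others-nonwhite : ∀ b → b ≢ c → ¬ White (P R (6 ↑ʳ b)))
  (α β δ : Permutation′ 4) (β0≡c : β ⟨$⟩ʳ 0F ≡ c) (δs≢0 : δ ⟨$⟩ʳ s ≢ 0F)
  (isotopic : IsotopicToΩ α β δ (lowerRight L subsquare))
  where

  S = lowerRight L subsquare

  ρ γ₁ δ₁ : Permutation′ 10
  ρ  = idₚ {6} ⊕ α
  γ₁ = idₚ {6} ⊕ β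
  δ₁ = δ ⊕ idₚ

  k : Fin 3
  k = proj₁ (nonzero⇒suc δs≢0)

  r : Fin 10 → Fin 10
  r j = δ₁ ⟨$⟩ʳ P R (γ₁ ⟨$⟩ʳ j)

  r-injective : Injective _≡_ _≡_ r
  r-injective = ⟨$⟩ʳ-injective γ₁ ∘ proj₁ latinP R _ _ ∘ ⟨$⟩ʳ-injective δ₁

  r₆ : r (# 6) ≡ suc k ↑ˡ 6
  r₆ = begin
    δ₁ ⟨$⟩ʳ P R (6 ↑ʳ (β ⟨$⟩ʳ 0F)) ≡⟨ cong (λ b → δ₁ ⟨$⟩ʳ P R (6 ↑ʳ b)) β0≡c ⟩
    δ₁ ⟨$⟩ʳ P R (6 ↑ʳ c)           ≡⟨ cong (δ₁ ⟨$⟩ʳ_) s≡PRc ⟨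
    δ₁ ⟨$⟩ʳ (s ↑ˡ 6)               ≡⟨ ⊕-↑ˡ δ idₚ s ⟩
    (δ ⟨$⟩ʳ s) ↑ˡ 6                ≡⟨ cong (_↑ˡ 6) (proj₂ (nonzero⇒suc δs≢0)) ⟨
    suc k ↑ˡ 6                     ∎
    where open ≡-Reasoning

  r-right-nonwhite : ∀ b → b ≢ 0F → ¬ White (r (6 ↑ʳ b))
  r-right-nonwhite b b≢0 = others-nonwhite (β ⟨$⟩ʳ b) βb≢c ∘ Equivalence.from (⊕-preservesBelow δ idₚ _)
    where
    βb≢c : β ⟨$⟩ʳ b ≢ c
    βb≢c βb≡c = b≢0 (⟨$⟩ʳ-injective β (trans βb≡c (sym β0≡c)))

  normalisation = row-normalisation r-injective k r₆ r-right-nonwhite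
  θ  = proj₁ normalisation
  π₃ = proj₁ (proj₂ normalisation)
  π₃-fixes-whites = proj₁ (proj₂ (proj₂ normalisation))

  γ π : Permutation′ 10
  γ = (θ ⊕ idₚ) ∘ₚ γ₁
  π = δ₁ ∘ₚ π₃

  colPerm : ColPerm γ
  colPerm =
    ∘ₚ-preservesBelow {π = θ ⊕ idₚ} {γ₁} (⊕-preservesBelow θ idₚ) (⊕-preservesBelow (idₚ {6}) β)

  symPerm : SymPerm π
  symPerm =
    ∘ₚ-preservesBelow {π = δ₁} {π₃} (⊕-preservesBelow δ idₚ) (fixesBelow⇒preservesBelow {π = π₃} π₃-fixes-whites)

  normalFirstRow : ∀ j → transform idₚ γ π P R j ≡ lookup (normalRow k) j
  normalFirstRow = proj₂ (proj₂ (proj₂ normalisation))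

  subsquare-isotope : ∀ a b → transform ρ γ π L (6 ↑ʳ a) (6 ↑ʳ b) ≡ isotope α β δ S a b ↑ˡ 6
  subsquare-isotope a b = begin
    π₃ ⟨$⟩ʳ (δ₁ ⟨$⟩ʳ L (6 ↑ʳ (α ⟨$⟩ʳ a)) (6 ↑ʳ (β ⟨$⟩ʳ b)))
      ≡⟨ cong (λ x → π₃ ⟨$⟩ʳ (δ₁ ⟨$⟩ʳ x)) (lowerRight-↑ˡ L subsquare _ _) ⟨
    π₃ ⟨$⟩ʳ (δ₁ ⟨$⟩ʳ (S (α ⟨$⟩ʳ a) (β ⟨$⟩ʳ b) ↑ˡ 6))
      ≡⟨ cong (π₃ ⟨$⟩ʳ_) (⊕-↑ˡ {4} {6} δ idₚ _) ⟩
    π₃ ⟨$⟩ʳ (isotope α β δ S a b ↑ˡ 6)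
      ≡⟨ π₃-fixes-whites _ (↑ˡ-below 6 _) ⟩
    isotope α β δ S a b ↑ˡ 6
      ∎
    where open ≡-Reasoning

  subsquareIs : SubsquareIs (transform ρ γ π L) Ω₁ ⊎ SubsquareIs (transform ρ γ π L) Ω₂
  subsquareIs = Sum.map (subsquare-is {Ω₁} Ω₁≡ω₁) (subsquare-is {Ω₂} Ω₂≡ω₂) isotopic
    where
    subsquare-is : ∀ {Ω ω} → (∀ a b → lookup (lookup Ω a) b ≡ ω a b ↑ˡ 6) → isotope α β δ S ≗₂ ω →
                   SubsquareIs (transform ρ γ π L) Ω
    subsquare-is Ω≡ω S≗ω a b =
      trans (subsquare-isotope a b) (trans (cong (_↑ˡ 6) (S≗ω a b)) (sym (Ω≡ω a b)))

opaque
  normalising-isotopy : ∀ {L P} → IsLatin L → LowerRightOn0123 L → IsLatin P → IsTRP P L →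
    ∃ λ ρ → ∃₂ λ γ π → ColPerm γ × SymPerm π ×
      (SubsquareIs (transform ρ γ π L) Ω₁ ⊎ SubsquareIs (transform ρ γ π L) Ω₂) ×
      ∃₂ λ R k → ∀ j → transform idₚ γ π P R j ≡ lookup (normalRow k) j
  normalising-isotopy latinL subsquare latinP trp =
    let R , c , s , s≡PRc , others-nonwhite = ttype-one-row latinP latinL subsquare trp
        α , β , δ , β0≡c , δs≢0 , isotopic  = subsquare-normalisation (lowerRight-latin latinL subsquare) c s
        open NormalisingIsotopy latinL subsquare latinP R c s s≡PRc others-nonwhite α β δ β0≡c δs≢0 isotopic
    in ρ , γ , π , colPerm , symPerm , subsquareIs , R , k , normalFirstRow

sorting-normalForm : ∀ {L P Q} → IsLatin L → LowerRightOn0123 L → (latinP : IsLatin P) → (latinQ : IsLatin Q) →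
  IsTRP P L → ∀ {R} k → (∀ j → P R j ≡ lookup (normalRow k) j) →
  NormalForm L (transform (RowSorting.sorting P latinP) idₚ idₚ P)
               (transform (RowSorting.sorting Q latinQ) idₚ idₚ Q)
sorting-normalForm {L} {P} {Q} latinL subsquare latinP latinQ trp {R} k PR≡t =
  SP.sorting-rowsSorted , SQ.sorting-rowsSorted , firstRow-cong first (normalRow-first k) ,
  normalRow-coloured latinL subsquare (transform-trp SP.sorting idₚ idₚ idₚ trp) k first
  where
  module SP = RowSorting P latinP
  module SQ = RowSorting Q latinQ

  R-ttype : ttype P R ≡ 1
  R-ttype =
    trans (ttype≡sum P R) (trans (sum-cong-≗ (λ b → cong (𝟙 ∘ white?) (PR≡t (6 ↑ʳ b)))) (normalRow-ttype k))

  -- R has the least type, and among rows of type 1 the least symbol, 0, in column 0.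
  R-least : ∀ y → y ≢ R → R ≺⟨ P ⟩ y
  R-least y y≢R = by-type (m≤n⇒m<n∨m≡n (ttype-positive latinP latinL subsquare trp y))
    where
    PR0≡0 : P R zero ≡ zero
    PR0≡0 = trans (PR≡t zero) (normalRow-column₀ k)
    PR0<Py0 : toℕ (P R zero) < toℕ (P y zero)
    PR0<Py0 = subst (λ x → toℕ x < toℕ (P y zero)) (sym PR0≡0) (n≢0⇒n>0 Py0≢0)
      where
      Py0≢0 : toℕ (P y zero) ≢ 0
      Py0≢0 Py0≡0 = y≢R (proj₂ latinP zero y R (Finₚ.toℕ-injective (trans Py0≡0 (cong toℕ (sym PR0≡0)))))
    by-type : 1 < ttype P y ⊎ 1 ≡ ttype P y → R ≺⟨ P ⟩ y
    by-type (inj₁ 1<t) = inj₁ (subst (_< ttype P y) (sym R-ttype) 1<t)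
    by-type (inj₂ 1≡t) = inj₂ (trans R-ttype 1≡t , zero , (λ _ ()) , PR0<Py0)

  first : ∀ j → P (SP.sorting ⟨$⟩ʳ zero) j ≡ lookup (normalRow k) j
  first j = trans (cong (λ i → P i j) (SP.sorting-least R R-least refl)) (PR≡t j)

theorem2 : (L P Q : Square) → IsLatin L → LowerRightOn0123 L →
    IsLatin P → IsLatin Q → IsTRP P Q → IsTRP P L → IsTRP Q L →
    Σ (Permutation′ 10) λ σ → Σ (Permutation′ 10) λ τ → Σ (Permutation′ 10) λ ρ →
    Σ (Permutation′ 10) λ γ → Σ (Permutation′ 10) λ π →
      ColPerm γ × SymPerm π ×
      (let P′ = transform σ γ π P
           Q′ = transform τ γ π Q
           L′ = transform ρ γ π L
       in IsTRP P′ Q′ × NormalForm L′ P′ Q′ ×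
          (SubsquareIs L′ Ω₁ ⊎ SubsquareIs L′ Ω₂) ×
          IsTRP P′ L′ × IsTRP Q′ L′)
theorem2 L P Q latinL subsquare latinP latinQ trpPQ trpPL trpQL =
  let ρ , γ , π , colPerm , symPerm , subsquareIs , R , k , normalFirstRow =
        normalising-isotopy latinL subsquare latinP trpPL
      L′ = transform ρ γ π L
      P₀ = transform idₚ γ π P
      Q₀ = transform idₚ γ π Q
      latinP₀ = isotope-latin idₚ γ π latinP
      latinQ₀ = isotope-latin idₚ γ π latinQ
      σ = RowSorting.sorting P₀ latinP₀
      τ = RowSorting.sorting Q₀ latinQ₀
      normalForm = sorting-normalForm {L′} {P₀} {Q₀} (isotope-latin ρ γ π latinL)
        (subsquareIs⇒lowerRightOn0123 {L′} subsquareIs) latinP₀ latinQ₀ (transform-trp idₚ ρ γ π trpPL) {R} k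
        normalFirstRow
  in σ , τ , ρ , γ , π , colPerm , symPerm , transform-trp σ τ γ π trpPQ ,
     subst₂ (NormalForm L′) (transform-rows σ γ π P) (transform-rows τ γ π Q) normalForm ,
     subsquareIs , transform-trp σ ρ γ π trpPL , transform-trp τ ρ γ π trpQL
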